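{- For every integer $k\ge 3$, $T_k(k+3)=k+5$. Moreover, up to isomorphism the only extremal graphs (triangle-free graphs on $k+4$ vertices containing no $k$-sparse set of $k+3$ vertices) are the complete bipartite graph $K_{2,k+2}$ and the graph obtained from $K_{2,k+2}$ by deleting one edge.
   Context: All graphs are finite and simple. A set $S$ of vertices of a graph $G$ is $k$-sparse if the induced subgraph $G[S]$ has maximum degree at most $k$. For integers $k\ge0$ and $j\ge1$, $T_k(j)$ denotes the minimum $n$ such that every triangle-free graph on $n$ vertices contains a $k$-sparse set of $j$ vertices. An extremal graph for $T_k(j)$ is a triangle-free graph on $T_k(j)-1$ vertices containing no $k$-sparse set of $j$ vertices. -}

module Defs where

open import Data.Nat using (ℕ; zero; suc; _+_; _≤_; _<_; _<ᵇ_; _≡ᵇ_)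
open import Data.Bool using (Bool; true; false; _∧_; _∨_; not; _xor_; if_then_else_)
open import Data.Bool.Properties using (∨-comm)
open import Data.Fin using (Fin; toℕ; zero; suc)
open import Data.Fin.Subset using (Subset; _∈_; _∩_; ∣_∣)
open import Data.Vec using (tabulate)
open import Data.Product using (Σ; _×_; _,_; ∃)
open import Function.Bundles using (_↔_; Inverse)
open import Relation.Binary.PropositionalEquality using (_≡_; refl; cong₂)
open import Relation.Nullary using (¬_)

record Graph (n : ℕ) : Set where
  field
    Adj   : Fin n → Fin n → Bool
    sym   : ∀ u v → Adj u v ≡ Adj v u
    irrfl : ∀ v → Adj v v ≡ false
open Graph public

TriangleFree : ∀ {n} → Graph n → Set
TriangleFree G = ∀ u v w → ¬ (Adj G u v ≡ true × Adj G v w ≡ true × Adj G u w ≡ true)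

nbhd : ∀ {n} → Graph n → Fin n → Subset n
nbhd G v = tabulate (Adj G v)

Sparse : ∀ {n} → ℕ → Graph n → Subset n → Set
Sparse k G S = ∀ v → v ∈ S → ∣ S ∩ nbhd G v ∣ ≤ k

HasSparseSet : ∀ {n} → ℕ → ℕ → Graph n → Set
HasSparseSet k j G = Σ (Subset _) λ S → ∣ S ∣ ≡ j × Sparse k G S

EveryTFHas : ℕ → ℕ → ℕ → Set
EveryTFHas k j n = (G : Graph n) → TriangleFree G → HasSparseSet k j G

-- T_k(j) = m : m is the minimum n with EveryTFHas k j n.
IsT : ℕ → ℕ → ℕ → Set
IsT k j m = EveryTFHas k j m × (∀ n → n < m → ¬ EveryTFHas k j n)

-- Extremal graph for T_k(j) on n (= T_k(j) - 1) vertices.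
Extremal : ∀ {n} → ℕ → ℕ → Graph n → Set
Extremal k j G = TriangleFree G × ¬ HasSparseSet k j G

_≅_ : ∀ {n m} → Graph n → Graph m → Set
_≅_ {n} {m} G H = Σ (Fin n ↔ Fin m) λ f →
  ∀ u v → Adj H (Inverse.to f u) (Inverse.to f v) ≡ Adj G u v

private
  xor-comm : ∀ x y → x xor y ≡ y xor x
  xor-comm false false = refl
  xor-comm false true  = refl
  xor-comm true  false = refl
  xor-comm true  true  = refl

  xor-self : ∀ x → x xor x ≡ false
  xor-self false = refl
  xor-self true  = refl

  ∧-false : ∀ x → x ∧ false ≡ false
  ∧-false false = refl
  ∧-false true  = refl

-- Complete bipartite graph on Fin n with parts {v : toℕ v < a} and the rest.
-- With n = a + b this is K_{a,b}.
completeBip : (n a : ℕ) → Graph n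
completeBip n a = record
  { Adj   = λ u v → (toℕ u <ᵇ a) xor (toℕ v <ᵇ a)
  ; sym   = λ u v → xor-comm (toℕ u <ᵇ a) (toℕ v <ᵇ a)
  ; irrfl = λ v → xor-self (toℕ v <ᵇ a) }

-- Delete the edge between the vertices numbered x and y (if present) from G
-- (vertices are identified by their index toℕ).
deleteEdge : ∀ {n} → Graph n → ℕ → ℕ → Graph n
deleteEdge G x y = record
  { Adj   = λ u v → Adj G u v ∧ not (isE u v ∨ isE v u)
  ; sym   = λ u v → cong₂ (λ p q → p ∧ not q) (Graph.sym G u v) (∨-comm (isE u v) (isE v u))
  ; irrfl = λ v → helper v }
  where
  isE : _ → _ → Bool
  isE u v = (toℕ u ≡ᵇ x) ∧ (toℕ v ≡ᵇ y)
  helper : ∀ v → Adj G v v ∧ not (isE v v ∨ isE v v) ≡ false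
  helper v rewrite Graph.irrfl G v = refl

-- Let U be a (k+4)-set in a triangle-free graph none of whose (k+3)-subsets is k-sparse.
-- Take v of maximum degree in G[U], and u of degree > k in G[U - v]. Both have more than
-- k neighbours in U, so they cannot be adjacent: adjacent vertices have disjoint
-- neighbourhoods, and 2(k+1) > k+4. If v missed one of the k+2 remaining vertices (the
-- leaves), say w, then v would have degree k+1; removing a neighbour x ≠ w of u then
-- leaves no vertex of degree > k in U - x, a contradiction. So v is adjacent to all
-- leaves, the leaves are independent, and since u has more than k neighbours it misses at
-- most one leaf: G[U] is K_{2,k+2}, possibly minus one edge at u. These two graphs have no
-- k-sparse (k+3)-set, which gives the extremal graphs and the lower bound. On k+5
-- vertices, apply this to U = V - z: deleting both hubs (if z is adjacent to a hub) or two
-- leaves (otherwise) leaves a k-sparse (k+3)-set, since every leaf is a neighbour of v,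
-- which has degree at least k+2, and so has degree at most 3.

module Submission where

open import Defs hiding (sym)
open import Data.Bool as Bool using (true; false; if_then_else_; _xor_)
open import Data.Bool.Properties using (¬-not; ∧-conicalˡ)
open import Data.Empty using (⊥; ⊥-elim)
open import Data.Fin using (Fin; zero; suc; toℕ; _≟_)
open import Data.Fin.Permutation
  using (Permutation; Permutation′; _⟨$⟩ʳ_; _⟨$⟩ˡ_; inverseˡ; inverseʳ; id; transpose; _∘ₚ_)
open import Data.Fin.Properties using (any?; all?)
open import Data.Fin.Subset using (Subset; _∈_; _∉_; _⊆_; _∩_; _─_; _-_; ∣_∣; ⁅_⁆; ⊤; Nonempty; inside; outside)
open import Data.Fin.Subset.Properties
  using (_∈?_; ∈⊤; ∣⊤∣≡n; ∣p∣≤n; ∣p∣≡n⇒p≡⊤; p⊆q⇒∣p∣≤∣q∣; p─⊥≡p; p─q⊆p; x∈p∩q⁺; x∈p∩q⁻;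
         x∈p∧x≢y⇒x∈p-y; x∈p∧x∉q⇒x∈p─q)
open import Data.List using (List; []; _∷_; length)
open import Data.List.Membership.Propositional using () renaming (_∈_ to _∈ₗ_; _∉_ to _∉ₗ_)
open import Data.List.Relation.Unary.All as All using (All; []; _∷_; zipWith)
open import Data.List.Relation.Unary.AllPairs using ([]; _∷_)
open import Data.List.Relation.Unary.Any using (here; there)
open import Data.List.Relation.Unary.Unique.Propositional using (Unique)
open import Data.Nat using (ℕ; zero; suc; _+_; _≤_; _<_; z≤n; s≤s; _≤?_; _<?_; _<ᵇ_)
open import Data.Nat.Properties renaming (_≟_ to _≟ℕ_)
open import Data.Product using (Σ; ∃; _×_; _,_)
open import Data.Sum using (_⊎_; inj₁; inj₂)
open import Data.Vec using ([]; _∷_; here; there)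
open import Data.Vec.Properties using ([]=⇒lookup; lookup⇒[]=; lookup∘tabulate)
open import Function using (_∘_)
open import Function.Bundles using (_⇔_; mk⇔)
open import Relation.Binary.PropositionalEquality
open import Relation.Nullary using (¬_; Dec; yes; no; does)
open import Relation.Nullary.Decidable using (_×-dec_; _→-dec_; ¬?; dec-true; dec-false)

private variable
  n : ℕ
  p q S : Subset n
  a b w x : Fin n
  G : Graph n

∣p∣≡1+∣p-x∣ : x ∈ p → ∣ p ∣ ≡ suc ∣ p - x ∣
∣p∣≡1+∣p-x∣ {p = inside ∷ p} here        = cong (λ r → suc ∣ r ∣) (sym (p─⊥≡p p))
∣p∣≡1+∣p-x∣ {p = inside ∷ p} (there x∈p) = cong suc (∣p∣≡1+∣p-x∣ x∈p)
∣p∣≡1+∣p-x∣ {p = outside ∷ p} (there x∈p) = ∣p∣≡1+∣p-x∣ x∈p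

∣p-x∣≡pred : ∀ (p : Subset n) {x m} → x ∈ p → ∣ p ∣ ≡ suc m → ∣ p - x ∣ ≡ m
∣p-x∣≡pred p x∈p ∣p∣≡1+m = suc-injective (trans (sym (∣p∣≡1+∣p-x∣ x∈p)) ∣p∣≡1+m)

x∉p-x : x ∉ p - x
x∉p-x {x = zero}  {p = _ ∷ _} ()
x∉p-x {x = suc x} {p = _ ∷ _} (there x∈p-x) = x∉p-x x∈p-x

x∈p-y⇒x≢y : ∀ {y} → x ∈ p - y → x ≢ y
x∈p-y⇒x≢y x∈p-x refl = x∉p-x x∈p-x

∈p-x-y⁻ : ∀ {y} → w ∈ p - x - y → w ∈ p × w ≢ x × w ≢ y
∈p-x-y⁻ {p = p} {x} {y} w∈p-x-y =
  let w∈p-x = p─q⊆p (p - x) ⁅ y ⁆ w∈p-x-y in p─q⊆p p ⁅ x ⁆ w∈p-x , x∈p-y⇒x≢y w∈p-x , x∈p-y⇒x≢y w∈p-x-y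

∣p∣≡2+∣p-x-y∣ : ∀ {y} → x ∈ p → y ∈ p → x ≢ y → ∣ p ∣ ≡ 2 + ∣ p - x - y ∣
∣p∣≡2+∣p-x-y∣ {p = p} {x} x∈p y∈p x≢y =
  trans (∣p∣≡1+∣p-x∣ x∈p) (cong suc (∣p∣≡1+∣p-x∣ (x∈p∧x≢y⇒x∈p-y y∈p (≢-sym x≢y))))

∣p∣≤1+∣p-x∣ : ∀ (p : Subset n) x → ∣ p ∣ ≤ suc ∣ p - x ∣
∣p∣≤1+∣p-x∣ p x with x ∈? p
... | yes x∈p = ≤-reflexive (∣p∣≡1+∣p-x∣ x∈p)
... | no  x∉p = m≤n⇒m≤1+n (p⊆q⇒∣p∣≤∣q∣ {p = p} {q = p - x} λ y∈p → x∈p∧x≢y⇒x∈p-y y∈p λ { refl → x∉p y∈p })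

nonempty : 0 < ∣ p ∣ → Nonempty p
nonempty {p = inside  ∷ p} _      = zero , here
nonempty {p = outside ∷ p} 0<∣p∣ with nonempty 0<∣p∣
... | x , x∈p = suc x , there x∈p

∃∉-of-length<∣p∣ : (xs : List (Fin n)) → length xs < ∣ p ∣ → ∃ λ x → x ∈ p × x ∉ₗ xs
∃∉-of-length<∣p∣ [] 0<∣p∣ with nonempty 0<∣p∣
... | x , x∈p = x , x∈p , λ ()
∃∉-of-length<∣p∣ {p = p} (y ∷ ys) ∣ys∣<∣p-y∣ with ∃∉-of-length<∣p∣ ys (≤-pred (≤-trans ∣ys∣<∣p-y∣ (∣p∣≤1+∣p-x∣ p y)))
... | x , x∈p-y , x∉ys = x , p─q⊆p p ⁅ y ⁆ x∈p-y , λ { (here refl) → x∉p-x x∈p-y ; (there x∈ys) → x∉ys x∈ys }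

length≤∣p∣ : ∀ {xs : List (Fin n)} → Unique xs → All (_∈ p) xs → length xs ≤ ∣ p ∣
length≤∣p∣ [] [] = z≤n
length≤∣p∣ {p = p} {x ∷ xs} (x≢xs ∷ uniq) (x∈p ∷ xs⊆p) = begin
  suc (length xs)  ≤⟨ s≤s (length≤∣p∣ uniq (zipWith (λ (x≢y , y∈p) → x∈p∧x≢y⇒x∈p-y y∈p (≢-sym x≢y)) (x≢xs , xs⊆p))) ⟩
  suc ∣ p - x ∣    ≡⟨ ∣p∣≡1+∣p-x∣ x∈p ⟨
  ∣ p ∣            ∎
  where open ≤-Reasoning

distinct₃ : ∀ {A : Set} {x y z : A} → x ≢ y → x ≢ z → y ≢ z → Unique (x ∷ y ∷ z ∷ [])
distinct₃ x≢y x≢z y≢z = (x≢y ∷ x≢z ∷ []) ∷ (y≢z ∷ []) ∷ [] ∷ []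

∣p∩q∣+∣p─q∣≡∣p∣ : ∀ (p q : Subset n) → ∣ p ∩ q ∣ + ∣ p ─ q ∣ ≡ ∣ p ∣
∣p∩q∣+∣p─q∣≡∣p∣ []            []            = refl
∣p∩q∣+∣p─q∣≡∣p∣ (inside  ∷ p) (inside  ∷ q) = cong suc (∣p∩q∣+∣p─q∣≡∣p∣ p q)
∣p∩q∣+∣p─q∣≡∣p∣ (inside  ∷ p) (outside ∷ q) = trans (+-suc _ _) (cong suc (∣p∩q∣+∣p─q∣≡∣p∣ p q))
∣p∩q∣+∣p─q∣≡∣p∣ (outside ∷ p) (inside  ∷ q) = ∣p∩q∣+∣p─q∣≡∣p∣ p q
∣p∩q∣+∣p─q∣≡∣p∣ (outside ∷ p) (outside ∷ q) = ∣p∩q∣+∣p─q∣≡∣p∣ p q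

x∈p─q⇒x∉q : x ∈ p ─ q → x ∉ q
x∈p─q⇒x∉q {p = inside ∷ _} {q = outside ∷ _} here ()
x∈p─q⇒x∉q {p = _ ∷ _}      {q = _ ∷ _}       (there x∈p─q) (there x∈q) = x∈p─q⇒x∉q x∈p─q x∈q

adj-sym : ∀ (G : Graph n) {a b t} → Adj G a b ≡ t → Adj G b a ≡ t
adj-sym G {a} {b} = trans (Graph.sym G b a)

adj⇒≢ : ∀ (G : Graph n) {a b} → Adj G a b ≡ true → a ≢ b
adj⇒≢ G {a} a∼a refl with () ← trans (sym (irrfl G a)) a∼a

∈nbhd⇒adj : ∀ (G : Graph n) {w x} → x ∈ nbhd G w → Adj G w x ≡ true
∈nbhd⇒adj G {w} {x} x∈N = trans (sym (lookup∘tabulate (Adj G w) x)) ([]=⇒lookup x∈N)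

adj⇒∈nbhd : ∀ (G : Graph n) {w x} → Adj G w x ≡ true → x ∈ nbhd G w
adj⇒∈nbhd G {w} {x} w∼x = lookup⇒[]= x (nbhd G w) (trans (lookup∘tabulate (Adj G w) x) w∼x)

nonadj⇒∉nbhd : ∀ (G : Graph n) {w x} → Adj G w x ≡ false → x ∉ nbhd G w
nonadj⇒∉nbhd G w≁x x∈N with () ← trans (sym w≁x) (∈nbhd⇒adj G x∈N)

deg : Graph n → Subset n → Fin n → ℕ
deg G S w = ∣ S ∩ nbhd G w ∣

∃nonneighbour∉ : ∀ (G : Graph n) {S w} (xs : List (Fin n)) → length xs + deg G S w < ∣ S ∣ →
                 ∃ λ x → x ∈ S × Adj G w x ≡ false × x ∉ₗ xs
∃nonneighbour∉ G {S} {w} xs lt with ∃∉-of-length<∣p∣ {p = S ─ nbhd G w} xs (+-cancelʳ-< _ _ _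
    (subst (length xs + deg G S w <_) (trans (sym (∣p∩q∣+∣p─q∣≡∣p∣ S (nbhd G w))) (+-comm (deg G S w) _)) lt))
... | x , x∈S─N , x∉xs = x , p─q⊆p S _ x∈S─N , ¬-not (x∈p─q⇒x∉q x∈S─N ∘ adj⇒∈nbhd G) , x∉xs

∃neighbour∉ : ∀ (G : Graph n) {S w} (xs : List (Fin n)) → length xs < deg G S w →
              ∃ λ x → x ∈ S × Adj G w x ≡ true × x ∉ₗ xs
∃neighbour∉ G {S} {w} xs lt with ∃∉-of-length<∣p∣ xs lt
... | x , x∈S∩N , x∉xs = let (x∈S , x∈N) = x∈p∩q⁻ S (nbhd G w) x∈S∩N in x , x∈S , ∈nbhd⇒adj G x∈N , x∉xs

∣S∣≤length+deg : ∀ (G : Graph n) {S w} (xs : List (Fin n)) →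
                 (∀ {x} → x ∈ S → Adj G w x ≡ false → x ∈ₗ xs) → ∣ S ∣ ≤ length xs + deg G S w
∣S∣≤length+deg G xs covers = ≮⇒≥ λ lt →
  let (x , x∈S , w≁x , x∉xs) = ∃nonneighbour∉ G xs lt in x∉xs (covers x∈S w≁x)

deg≤-by-nonneighbours : ∀ (G : Graph n) {S w} {xs : List (Fin n)} {d} → ∣ S ∣ ≡ length xs + d → Unique xs →
                        All (λ x → x ∈ S × Adj G w x ≡ false) xs → deg G S w ≤ d
deg≤-by-nonneighbours G {S} {w} {xs} {d} ∣S∣≡ uniq nonneighbours = +-cancelˡ-≤ (length xs) _ _ (begin
  length xs + deg G S w             ≤⟨ +-monoˡ-≤ _ (length≤∣p∣ uniq (All.map inS─N nonneighbours)) ⟩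
  ∣ S ─ nbhd G w ∣ + deg G S w      ≡⟨ +-comm ∣ S ─ nbhd G w ∣ (deg G S w) ⟩
  deg G S w + ∣ S ─ nbhd G w ∣      ≡⟨ ∣p∩q∣+∣p─q∣≡∣p∣ S (nbhd G w) ⟩
  ∣ S ∣                             ≡⟨ ∣S∣≡ ⟩
  length xs + d                     ∎)
  where
  open ≤-Reasoning
  inS─N : ∀ {x} → x ∈ S × Adj G w x ≡ false → x ∈ S ─ nbhd G w
  inS─N (x∈S , w≁x) = x∈p∧x∉q⇒x∈p─q x∈S (nonadj⇒∉nbhd G w≁x)

deg+deg≤∣S∣ : ∀ (G : Graph n) {S a b} → TriangleFree G → Adj G a b ≡ true → deg G S a + deg G S b ≤ ∣ S ∣
deg+deg≤∣S∣ G {S} {a} {b} tf a∼b = begin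
  deg G S a + deg G S b             ≤⟨ +-monoʳ-≤ (deg G S a) (p⊆q⇒∣p∣≤∣q∣ N[b]⊆S─N[a]) ⟩
  deg G S a + ∣ S ─ nbhd G a ∣      ≡⟨ ∣p∩q∣+∣p─q∣≡∣p∣ S (nbhd G a) ⟩
  ∣ S ∣                             ∎
  where
  open ≤-Reasoning
  N[b]⊆S─N[a] : S ∩ nbhd G b ⊆ S ─ nbhd G a
  N[b]⊆S─N[a] x∈S∩N[b] =
    let (x∈S , x∈N[b]) = x∈p∩q⁻ S (nbhd G b) x∈S∩N[b]
    in x∈p∧x∉q⇒x∈p─q x∈S λ x∈N[a] → tf a b _ (a∼b , ∈nbhd⇒adj G x∈N[b] , ∈nbhd⇒adj G x∈N[a])

deg-mono : ∀ (G : Graph n) {p q} w → p ⊆ q → deg G p w ≤ deg G q w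
deg-mono G {p} {q} w p⊆q = p⊆q⇒∣p∣≤∣q∣ λ x∈p∩N →
  let (x∈p , x∈N) = x∈p∩q⁻ p (nbhd G w) x∈p∩N in x∈p∩q⁺ (p⊆q x∈p , x∈N)

deg-remove-neighbour : ∀ (G : Graph n) {S x w} → x ∈ S → Adj G w x ≡ true → deg G (S - x) w < deg G S w
deg-remove-neighbour G {S} {x} {w} x∈S w∼x = begin-strict
  deg G (S - x) w                   ≤⟨ p⊆q⇒∣p∣≤∣q∣ (λ y∈S-x∩N →
                                         let (y∈S-x , y∈N) = x∈p∩q⁻ (S - x) (nbhd G w) y∈S-x∩N
                                         in x∈p∧x≢y⇒x∈p-y (x∈p∩q⁺ (p─q⊆p S _ y∈S-x , y∈N)) (x∈p-y⇒x≢y y∈S-x)) ⟩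
  ∣ (S ∩ nbhd G w) - x ∣            <⟨ n<1+n _ ⟩
  suc ∣ (S ∩ nbhd G w) - x ∣        ≡⟨ ∣p∣≡1+∣p-x∣ (x∈p∩q⁺ (x∈S , adj⇒∈nbhd G w∼x)) ⟨
  deg G S w                         ∎
  where open ≤-Reasoning

violator : ∀ k (G : Graph n) S → ¬ Sparse k G S → ∃ λ w → w ∈ S × k < deg G S w
violator k G S ¬sparse with any? (λ w → (w ∈? S) ×-dec (k <? deg G S w))
... | yes found = found
... | no  none  = ⊥-elim (¬sparse λ w w∈S → ≮⇒≥ λ k<deg → none (w , w∈S , k<deg))

sparse? : ∀ k (G : Graph n) S → Dec (Sparse k G S)
sparse? k G S = all? λ w → (w ∈? S) →-dec (deg G S w ≤? k)

argmax : ∀ (f : Fin (suc n) → ℕ) → ∃ λ v → ∀ w → f w ≤ f v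
argmax {zero}  f = zero , λ { zero → ≤-refl }
argmax {suc n} f with argmax (f ∘ suc)
... | v , max with f zero ≤? f (suc v)
...   | yes f0≤ = suc v , λ { zero → f0≤ ; (suc w) → max w }
...   | no  f0≰ = zero  , λ { zero → ≤-refl ; (suc w) → ≤-trans (max w) (≰⇒≥ f0≰) }

-- Shifting the weights inside p by one puts every maximiser of weightOn p f inside p.
private
  weightOn : Subset n → (Fin n → ℕ) → Fin n → ℕ
  weightOn p f w = if does (w ∈? p) then suc (f w) else 0

  weightOn-∈ : ∀ (f : Fin n → ℕ) → w ∈ p → weightOn p f w ≡ suc (f w)
  weightOn-∈ {w = w} {p} f w∈p with w ∈? p
  ... | yes _   = refl
  ... | no  w∉p = ⊥-elim (w∉p w∈p)

  weightOn-∉ : ∀ (f : Fin n → ℕ) → w ∉ p → weightOn p f w ≡ 0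
  weightOn-∉ {w = w} {p} f w∉p with w ∈? p
  ... | yes w∈p = ⊥-elim (w∉p w∈p)
  ... | no  _   = refl

argmax-on : ∀ (p : Subset n) (f : Fin n → ℕ) → Nonempty p → ∃ λ v → v ∈ p × (∀ {w} → w ∈ p → f w ≤ f v)
argmax-on {suc n} p f (x , x∈p) with argmax (weightOn p f)
... | v , max = select (v ∈? p)
  where
  select : Dec (v ∈ p) → ∃ λ v → v ∈ p × (∀ {w} → w ∈ p → f w ≤ f v)
  select (yes v∈p) = v , v∈p , λ {w} w∈p → ≤-pred (subst₂ _≤_ (weightOn-∈ f w∈p) (weightOn-∈ f v∈p) (max w))
  select (no  v∉p) with () ← subst₂ _≤_ (weightOn-∈ f x∈p) (weightOn-∉ f v∉p) (max x)

-- (k+4)-sets whose (k+3)-subsets are not k-sparse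

Leaf : Subset n → Fin n → Fin n → Fin n → Set
Leaf U u v a = a ∈ U × a ≢ u × a ≢ v

-- G[U] is K_{2,|U|-2} with parts {u, v} and the leaves, possibly minus one edge at u.
record HubPair (G : Graph n) (U : Subset n) : Set where
  field
    u v           : Fin n
    u∈U           : u ∈ U
    v∈U           : v ∈ U
    u≢v           : u ≢ v
    u≁v           : Adj G u v ≡ false
    v∼leaf        : ∀ {a} → Leaf U u v a → Adj G v a ≡ true
    leaf≁leaf     : ∀ {a b} → Leaf U u v a → Leaf U u v b → Adj G a b ≡ false
    u≁leaf-unique : ∀ {a b} → Leaf U u v a → Leaf U u v b → Adj G u a ≡ false → Adj G u b ≡ false → a ≡ b

hub-or-leaf : ∀ {U : Subset n} u v → a ∈ U → a ≡ u ⊎ a ≡ v ⊎ Leaf U u v a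
hub-or-leaf {a = a} u v a∈U with a ≟ u | a ≟ v
... | yes a≡u | _       = inj₁ a≡u
... | no  _   | yes a≡v = inj₂ (inj₁ a≡v)
... | no  a≢u | no  a≢v = inj₂ (inj₂ (a∈U , a≢u , a≢v))

private
  ¬heavy-pair : ∀ {k d e} → 3 ≤ k → k < d → k < e → ¬ d + e ≤ 4 + k
  ¬heavy-pair {k} {d} {e} 3≤k k<d k<e d+e≤4+k = 1+n≰n (begin
    5 + k           ≤⟨ s≤s (s≤s (+-monoˡ-≤ k 3≤k)) ⟩
    2 + (k + k)     ≡⟨ cong suc (+-suc k k) ⟨
    suc k + suc k   ≤⟨ +-mono-≤ k<d k<e ⟩
    d + e           ≤⟨ d+e≤4+k ⟩
    4 + k           ∎)
    where open ≤-Reasoning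

module _ {G : Graph n} (tf : TriangleFree G) {k} (3≤k : 3 ≤ k) {U : Subset n} (∣U∣≡4+k : ∣ U ∣ ≡ 4 + k) where

  private
    D : Fin n → ℕ
    D = deg G U

    heavy⇒nonadj : k < D a → k < D b → Adj G a b ≡ false
    heavy⇒nonadj {a} {b} k<Da k<Db = ¬-not λ a∼b →
      ¬heavy-pair 3≤k k<Da k<Db (subst (D a + D b ≤_) ∣U∣≡4+k (deg+deg≤∣S∣ G {S = U} tf a∼b))

  module _ (¬sparse-deletions : ∀ x → x ∈ U → ¬ Sparse k G (U - x)) where

    private
      module Hubs {v} (v∈U : v ∈ U) (v-max : ∀ {w} → w ∈ U → D w ≤ D v)
                  {u} (u∈U-v : u ∈ U - v) (k<deg[U-v]u : k < deg G (U - v) u) where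

        u∈U : u ∈ U
        u∈U = p─q⊆p U ⁅ v ⁆ u∈U-v

        u≢v : u ≢ v
        u≢v = x∈p-y⇒x≢y u∈U-v

        u-heavy : k < D u
        u-heavy = ≤-trans k<deg[U-v]u (deg-mono G u (p─q⊆p U ⁅ v ⁆))

        v-heavy : k < D v
        v-heavy = ≤-trans u-heavy (v-max u∈U)

        u≁v : Adj G u v ≡ false
        u≁v = heavy⇒nonadj u-heavy v-heavy

        u≁leaf-unique : Leaf U u v a → Leaf U u v b → Adj G u a ≡ false → Adj G u b ≡ false → a ≡ b
        u≁leaf-unique {a} {b} (a∈U , a≢u , a≢v) (b∈U , b≢u , b≢v) u≁a u≁b with a ≟ b
        ... | yes a≡b = a≡b
        ... | no  a≢b = ⊥-elim (<⇒≱ u-heavy (deg≤-by-nonneighbours G ∣U∣≡4+k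
                ((u≢v ∷ ≢-sym a≢u ∷ ≢-sym b≢u ∷ []) ∷ (≢-sym a≢v ∷ ≢-sym b≢v ∷ []) ∷ (a≢b ∷ []) ∷ [] ∷ [])
                ((u∈U , irrfl G u) ∷ (v∈U , u≁v) ∷ (a∈U , u≁a) ∷ (b∈U , u≁b) ∷ [])))

        module _ {w} (w∈U : w ∈ U) (w≢u : w ≢ u) (w≢v : w ≢ v) (v≁w : Adj G v w ≡ false) where

          v∼other-leaf : Leaf U u v a → a ≢ w → Adj G v a ≡ true
          v∼other-leaf {a} (a∈U , a≢u , a≢v) a≢w = ¬-not λ v≁a →
            <⇒≱ v-heavy (deg≤-by-nonneighbours G ∣U∣≡4+k
              ((≢-sym u≢v ∷ ≢-sym w≢v ∷ ≢-sym a≢v ∷ []) ∷ (≢-sym w≢u ∷ ≢-sym a≢u ∷ []) ∷ (≢-sym a≢w ∷ []) ∷ [] ∷ [])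
              ((v∈U , irrfl G v) ∷ (u∈U , adj-sym G u≁v) ∷ (w∈U , v≁w) ∷ (a∈U , v≁a) ∷ []))

          Dv≤1+k : D v ≤ 1 + k
          Dv≤1+k = deg≤-by-nonneighbours G ∣U∣≡4+k (distinct₃ (≢-sym u≢v) (≢-sym w≢v) (≢-sym w≢u))
            ((v∈U , irrfl G v) ∷ (u∈U , adj-sym G u≁v) ∷ (w∈U , v≁w) ∷ [])

          x-choice : ∃ λ x → x ∈ U × Adj G u x ≡ true × x ∉ₗ w ∷ []
          x-choice = ∃neighbour∉ G (w ∷ []) (≤-trans (s≤s (≤-trans (s≤s z≤n) 3≤k)) u-heavy)

          -- In U - x: v and u lose their neighbour x, a leaf y ≠ w would be a heavy neighbour
          -- of v, and w is either a heavy neighbour of u or misses w, v, u among k + 3 vertices.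
          no-nonadjacent-leaf : ⊥
          no-nonadjacent-leaf with x-choice
          ... | x , x∈U , u∼x , x∉[w] = y-absurd (violator k G (U - x) (¬sparse-deletions x x∈U))
            where
            x≢u = ≢-sym (adj⇒≢ G u∼x)
            x≢v : x ≢ v
            x≢v refl with () ← trans (sym u≁v) u∼x
            x≢w : x ≢ w
            x≢w x≡w = x∉[w] (here x≡w)
            v∼x = v∼other-leaf (x∈U , x≢u , x≢v) x≢w

            y-absurd : (∃ λ y → y ∈ U - x × k < deg G (U - x) y) → ⊥
            y-absurd (y , y∈U-x , k<deg[U-x]y)
              with hub-or-leaf u v (p─q⊆p U ⁅ x ⁆ y∈U-x) | ≤-trans k<deg[U-x]y (deg-mono G y (p─q⊆p U ⁅ x ⁆))
            ... | inj₁ refl | _ = <⇒≱ k<deg[U-x]y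
                  (≤-pred (≤-trans (deg-remove-neighbour G x∈U u∼x) (≤-trans (v-max u∈U) Dv≤1+k)))
            ... | inj₂ (inj₁ refl) | _ = <⇒≱ k<deg[U-x]y (≤-pred (≤-trans (deg-remove-neighbour G x∈U v∼x) Dv≤1+k))
            ... | inj₂ (inj₂ (y∈U , y≢u , y≢v)) | y-heavy with y ≟ w
            ...   | no  y≢w with () ← trans (sym (heavy⇒nonadj v-heavy y-heavy)) (v∼other-leaf (y∈U , y≢u , y≢v) y≢w)
            ...   | yes refl with Adj G u w in u∼?w
            ...     | true  with () ← trans (sym (heavy⇒nonadj u-heavy y-heavy)) u∼?w
            ...     | false = <⇒≱ k<deg[U-x]y (deg≤-by-nonneighbours G (∣p-x∣≡pred U x∈U ∣U∣≡4+k)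
                (distinct₃ w≢v w≢u (≢-sym u≢v))
                ((y∈U-x , irrfl G w) ∷ (x∈p∧x≢y⇒x∈p-y v∈U (≢-sym x≢v) , adj-sym G v≁w)
                  ∷ (x∈p∧x≢y⇒x∈p-y u∈U (≢-sym x≢u) , adj-sym G u∼?w) ∷ []))

        v∼leaf : Leaf U u v a → Adj G v a ≡ true
        v∼leaf (a∈U , a≢u , a≢v) = ¬-not λ v≁a → no-nonadjacent-leaf a∈U a≢u a≢v v≁a

        hubPair : HubPair G U
        hubPair = record
          { u = u ; v = v ; u∈U = u∈U ; v∈U = v∈U ; u≢v = u≢v ; u≁v = u≁v ; v∼leaf = v∼leaf
          ; leaf≁leaf = λ a-leaf b-leaf → ¬-not λ a∼b → tf v _ _ (v∼leaf a-leaf , a∼b , v∼leaf b-leaf)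
          ; u≁leaf-unique = u≁leaf-unique }

    hubPair-of-¬sparse-deletions : HubPair G U
    hubPair-of-¬sparse-deletions with argmax-on U D (nonempty (subst (0 <_) (sym ∣U∣≡4+k) (s≤s z≤n)))
    ... | v , v∈U , v-max with violator k G (U - v) (¬sparse-deletions v v∈U)
    ... | u , u∈U-v , k<deg[U-v]u = Hubs.hubPair v∈U v-max u∈U-v k<deg[U-v]u

module _ {G : Graph n} {U : Subset n} (H : HubPair G U) where
  open HubPair H

  hub≁leaf-unique : ∀ {h} → h ≡ u ⊎ h ≡ v → Leaf U u v a → Leaf U u v b →
                    Adj G h a ≡ false → Adj G h b ≡ false → a ≡ b
  hub≁leaf-unique (inj₁ refl) a-leaf b-leaf h≁a h≁b = u≁leaf-unique a-leaf b-leaf h≁a h≁b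
  hub≁leaf-unique (inj₂ refl) a-leaf _ h≁a _ with () ← trans (sym h≁a) (v∼leaf a-leaf)

  ∣S∣≤2+deg[v] : S ⊆ U → ∣ S ∣ ≤ 2 + deg G S v
  ∣S∣≤2+deg[v] S⊆U = ∣S∣≤length+deg G (v ∷ u ∷ []) λ x∈S v≁x → nonneighbour (S⊆U x∈S) v≁x
    where
    nonneighbour : x ∈ U → Adj G v x ≡ false → x ∈ₗ v ∷ u ∷ []
    nonneighbour x∈U v≁x with hub-or-leaf u v x∈U
    ... | inj₁ x≡u          = there (here x≡u)
    ... | inj₂ (inj₁ x≡v)   = here x≡v
    ... | inj₂ (inj₂ x-leaf) with () ← trans (sym v≁x) (v∼leaf x-leaf)

  ¬sparse-∋v : ∀ {k} → S ⊆ U → ∣ S ∣ ≡ 3 + k → v ∈ S → ¬ Sparse k G S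
  ¬sparse-∋v {S = S} {k} S⊆U ∣S∣≡3+k v∈S sparse = 1+n≰n (+-cancelˡ-≤ 2 _ _ (begin
    3 + k              ≡⟨ ∣S∣≡3+k ⟨
    ∣ S ∣              ≤⟨ ∣S∣≤2+deg[v] S⊆U ⟩
    2 + deg G S v      ≤⟨ +-monoʳ-≤ 2 (sparse v v∈S) ⟩
    2 + k              ∎))
    where open ≤-Reasoning

  module _ {k} (∣U∣≡4+k : ∣ U ∣ ≡ 4 + k) {S} (S⊆U : S ⊆ U) (∣S∣≡3+k : ∣ S ∣ ≡ 3 + k) where

    private
      r+deg<∣S∣ : ∀ {r w} → r ≤ 2 → deg G S w ≤ k → r + deg G S w < ∣ S ∣
      r+deg<∣S∣ {w = w} r≤2 deg≤k = subst (_ + deg G S w <_) (sym ∣S∣≡3+k) (s≤s (+-mono-≤ r≤2 deg≤k))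

    ¬sparse-∌v∋u : v ∉ S → u ∈ S → ¬ Sparse k G S
    ¬sparse-∌v∋u v∉S u∈S sparse with ∃nonneighbour∉ G (u ∷ []) (r+deg<∣S∣ (s≤s z≤n) (sparse u u∈S))
    ... | a , a∈S , u≁a , a∉[u] with ∃nonneighbour∉ G (u ∷ a ∷ []) (r+deg<∣S∣ ≤-refl (sparse u u∈S))
    ... | b , b∈S , u≁b , b∉[u,a] = b∉[u,a] (there (here (sym
          (u≁leaf-unique (leaf a∈S (a∉[u] ∘ here)) (leaf b∈S (b∉[u,a] ∘ here)) u≁a u≁b))))
      where
      leaf : x ∈ S → x ≢ u → Leaf U u v x
      leaf x∈S x≢u = S⊆U x∈S , x≢u , λ { refl → v∉S x∈S }

    ¬v,u∉S : v ∉ S → u ∉ S → ⊥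
    ¬v,u∉S v∉S u∉S = 1+n≰n (+-cancelˡ-≤ 2 _ _ (begin
      2 + (3 + k)          ≡⟨ cong (2 +_) ∣S∣≡3+k ⟨
      2 + ∣ S ∣            ≤⟨ +-monoʳ-≤ 2 (p⊆q⇒∣p∣≤∣q∣ S⊆U-v-u) ⟩
      2 + ∣ U - v - u ∣    ≡⟨ ∣p∣≡2+∣p-x-y∣ v∈U u∈U (≢-sym u≢v) ⟨
      ∣ U ∣                ≡⟨ ∣U∣≡4+k ⟩
      4 + k                ∎))
      where
      open ≤-Reasoning
      S⊆U-v-u : S ⊆ U - v - u
      S⊆U-v-u x∈S = x∈p∧x≢y⇒x∈p-y (x∈p∧x≢y⇒x∈p-y (S⊆U x∈S) λ { refl → v∉S x∈S }) λ { refl → u∉S x∈S }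

    ¬sparse : ¬ Sparse k G S
    ¬sparse with v ∈? S | u ∈? S
    ... | yes v∈S | _       = ¬sparse-∋v S⊆U ∣S∣≡3+k v∈S
    ... | no  v∉S | yes u∈S = ¬sparse-∌v∋u v∉S u∈S
    ... | no  v∉S | no  u∉S = ⊥-elim (¬v,u∉S v∉S u∉S)

-- A k-sparse (k+3)-set among k+5 vertices

module _ {G : Graph n} (tf : TriangleFree G) {k} (3≤k : 3 ≤ k) (∣⊤∣≡5+k : ∣ ⊤ {n} ∣ ≡ 5 + k)
         {z} (H : HubPair G (⊤ - z)) where
  open HubPair H

  private
    ∣⊤-z∣≡4+k : ∣ ⊤ - z ∣ ≡ 4 + k
    ∣⊤-z∣≡4+k = ∣p-x∣≡pred (⊤ {n}) {z} ∈⊤ ∣⊤∣≡5+k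

    ∣⊤-x-y∣≡3+k : ∀ {x y} → x ≢ y → ∣ ⊤ - x - y ∣ ≡ 3 + k
    ∣⊤-x-y∣≡3+k x≢y = suc-injective (suc-injective (trans (sym (∣p∣≡2+∣p-x-y∣ {p = ⊤ {n}} ∈⊤ ∈⊤ x≢y)) ∣⊤∣≡5+k))

    2+k≤deg[v] : 2 + k ≤ deg G ⊤ v
    2+k≤deg[v] = +-cancelˡ-≤ 2 _ _ (begin
      4 + k                ≡⟨ ∣⊤-z∣≡4+k ⟨
      ∣ ⊤ - z ∣            ≤⟨ ∣S∣≤2+deg[v] H {S = ⊤ - z} (λ x∈U → x∈U) ⟩
      2 + deg G (⊤ - z) v  ≤⟨ +-monoʳ-≤ 2 (deg-mono G {⊤ - z} {⊤ {n}} v (λ _ → ∈⊤)) ⟩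
      2 + deg G ⊤ v        ∎)
      where open ≤-Reasoning

    leaf-light : ∀ S → Leaf (⊤ - z) u v a → deg G S a ≤ k
    leaf-light {a = a} S a-leaf = ≤-trans (deg-mono G {S} {⊤ {n}} a (λ _ → ∈⊤)) (≤-trans deg≤3 3≤k)
      where
      deg≤3 : deg G ⊤ a ≤ 3
      deg≤3 = +-cancelˡ-≤ (2 + k) _ _ (begin
        2 + k + deg G ⊤ a          ≤⟨ +-monoˡ-≤ _ 2+k≤deg[v] ⟩
        deg G ⊤ v + deg G ⊤ a      ≤⟨ deg+deg≤∣S∣ G {S = ⊤ {n}} tf (v∼leaf a-leaf) ⟩
        ∣ ⊤ {n} ∣                   ≡⟨ ∣⊤∣≡5+k ⟩
        5 + k                      ≡⟨ cong (2 +_) (+-comm 3 k) ⟩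
        2 + k + 3                  ∎)
        where open ≤-Reasoning

    ∈⊤-x-y : ∀ {x y} → w ≢ x → w ≢ y → w ∈ ⊤ - x - y
    ∈⊤-x-y w≢x w≢y = x∈p∧x≢y⇒x∈p-y (x∈p∧x≢y⇒x∈p-y ∈⊤ w≢x) w≢y

    v≢z : v ≢ z
    v≢z = x∈p-y⇒x≢y v∈U

    u≢z : u ≢ z
    u≢z = x∈p-y⇒x≢y u∈U

    two-leaves : ∃ λ a → ∃ λ b → Leaf (⊤ - z) u v a × Leaf (⊤ - z) u v b × a ≢ b
    two-leaves with ∃∉-of-length<∣p∣ (v ∷ u ∷ []) (subst (3 ≤_) (sym ∣⊤-z∣≡4+k) (≤-trans (n≤1+n 3) (m≤m+n 4 k)))
    ... | a , a∈U , a∉[v,u] with ∃∉-of-length<∣p∣ (v ∷ u ∷ a ∷ []) (subst (4 ≤_) (sym ∣⊤-z∣≡4+k) (m≤m+n 4 k))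
    ... | b , b∈U , b∉[v,u,a] =
      a , b , (a∈U , (λ a≡u → a∉[v,u] (there (here a≡u))) , a∉[v,u] ∘ here)
            , (b∈U , (λ b≡u → b∉[v,u,a] (there (here b≡u))) , b∉[v,u,a] ∘ here)
            , λ a≡b → b∉[v,u,a] (there (there (here (sym a≡b))))

    z-deg≤1 : ∀ {h} → h ≡ u ⊎ h ≡ v → Adj G z h ≡ true → deg G (⊤ - v - u) z ≤ 1
    z-deg≤1 {h} h-hub z∼h = ≮⇒≥ λ 1<deg →
      let (a , a∈S , z∼a , _)     = ∃neighbour∉ G [] (<⇒≤ 1<deg)
          (b , b∈S , z∼b , b∉[a]) = ∃neighbour∉ G (a ∷ []) 1<deg
      in b∉[a] (here (sym (hub≁leaf-unique H h-hub (leaf a∈S z∼a) (leaf b∈S z∼b) (h≁ z∼a) (h≁ z∼b))))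
      where
      leaf : x ∈ ⊤ - v - u → Adj G z x ≡ true → Leaf (⊤ - z) u v x
      leaf x∈S z∼x = let (_ , x≢v , x≢u) = ∈p-x-y⁻ x∈S in x∈p∧x≢y⇒x∈p-y ∈⊤ (≢-sym (adj⇒≢ G z∼x)) , x≢u , x≢v
      h≁ : Adj G z x ≡ true → Adj G h x ≡ false
      h≁ z∼x = ¬-not λ h∼x → tf z _ _ (z∼h , h∼x , z∼x)

    sparse-without-hubs : ∀ {h} → h ≡ u ⊎ h ≡ v → Adj G z h ≡ true → Sparse k G (⊤ - v - u)
    sparse-without-hubs h-hub z∼h w w∈S with w ≟ z
    ... | yes refl = ≤-trans (z-deg≤1 h-hub z∼h) (≤-trans (s≤s z≤n) 3≤k)
    ... | no  w≢z  = let (_ , w≢v , w≢u) = ∈p-x-y⁻ w∈S in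
                     leaf-light (⊤ - v - u) (x∈p∧x≢y⇒x∈p-y ∈⊤ w≢z , w≢u , w≢v)

    module _ (z≁u : Adj G z u ≡ false) (z≁v : Adj G z v ≡ false)
             {a b} (a∈U : a ∈ ⊤ - z) (a≢u : a ≢ u) (a≢v : a ≢ v)
                   (b∈U : b ∈ ⊤ - z) (b≢u : b ≢ u) (b≢v : b ≢ v) (a≢b : a ≢ b) where

      private
        z∈S = ∈⊤-x-y (≢-sym (x∈p-y⇒x≢y a∈U)) (≢-sym (x∈p-y⇒x≢y b∈U))
        u∈S = ∈⊤-x-y (≢-sym a≢u) (≢-sym b≢u)
        v∈S = ∈⊤-x-y (≢-sym a≢v) (≢-sym b≢v)

        light : ∀ {w x y} → Unique (w ∷ x ∷ y ∷ []) →
                All (λ t → t ∈ ⊤ - a - b × Adj G w t ≡ false) (w ∷ x ∷ y ∷ []) → deg G (⊤ - a - b) w ≤ k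
        light = deg≤-by-nonneighbours G (∣⊤-x-y∣≡3+k a≢b)

      sparse-without-leaves : Sparse k G (⊤ - a - b)
      sparse-without-leaves w w∈S with w ≟ z
      ... | yes refl = light (distinct₃ (≢-sym v≢z) (≢-sym u≢z) (≢-sym u≢v))
                             ((w∈S , irrfl G w) ∷ (v∈S , z≁v) ∷ (u∈S , z≁u) ∷ [])
      ... | no  w≢z with hub-or-leaf u v (x∈p∧x≢y⇒x∈p-y ∈⊤ w≢z)
      ...   | inj₁ refl          = light (distinct₃ u≢v u≢z v≢z)
                                         ((w∈S , irrfl G w) ∷ (v∈S , u≁v) ∷ (z∈S , adj-sym G z≁u) ∷ [])
      ...   | inj₂ (inj₁ refl)   = light (distinct₃ (≢-sym u≢v) v≢z u≢z)
                                         ((w∈S , irrfl G w) ∷ (u∈S , adj-sym G u≁v) ∷ (z∈S , adj-sym G z≁v) ∷ [])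
      ...   | inj₂ (inj₂ w-leaf) = leaf-light (⊤ - a - b) w-leaf

  sparse-set : Σ (Subset n) λ S → ∣ S ∣ ≡ 3 + k × Sparse k G S
  sparse-set with Adj G z u in z∼?u | Adj G z v in z∼?v
  ... | true  | _     = ⊤ - v - u , ∣⊤-x-y∣≡3+k (≢-sym u≢v) , sparse-without-hubs (inj₁ refl) z∼?u
  ... | false | true  = ⊤ - v - u , ∣⊤-x-y∣≡3+k (≢-sym u≢v) , sparse-without-hubs (inj₂ refl) z∼?v
  ... | false | false with two-leaves
  ...   | a , b , (a∈U , a≢u , a≢v) , (b∈U , b≢u , b≢v) , a≢b =
          ⊤ - a - b , ∣⊤-x-y∣≡3+k a≢b , sparse-without-leaves z∼?u z∼?v a∈U a≢u a≢v b∈U b≢u b≢v a≢b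

-- The graphs K_{2,n-2} and K_{2,n-2} minus an edge

completeBip-triangleFree : ∀ n a → TriangleFree (completeBip n a)
completeBip-triangleFree n a x y z (x∼y , y∼z , x∼z) = xor-triangle (toℕ x <ᵇ a) (toℕ y <ᵇ a) (toℕ z <ᵇ a) x∼y y∼z x∼z
  where
  xor-triangle : ∀ p q r → p xor q ≡ true → q xor r ≡ true → p xor r ≡ true → ⊥
  xor-triangle false false _     () _  _
  xor-triangle true  true  _     () _  _
  xor-triangle false true  true  _  () _
  xor-triangle true  false false _  () _
  xor-triangle false true  false _  _  ()
  xor-triangle true  false true  _  _  ()

deleteEdge-triangleFree : ∀ (G : Graph n) x y → TriangleFree G → TriangleFree (deleteEdge G x y)
deleteEdge-triangleFree G x y tf a b c (a∼b , b∼c , a∼c) =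
  tf a b c (∧-conicalˡ _ _ a∼b , ∧-conicalˡ _ _ b∼c , ∧-conicalˡ _ _ a∼c)

≅-triangleFree : ∀ {m} {G : Graph n} {H : Graph m} → G ≅ H → TriangleFree H → TriangleFree G
≅-triangleFree (f , f-adj) tfH a b c (a∼b , b∼c , a∼c) =
  tfH (f ⟨$⟩ʳ a) (f ⟨$⟩ʳ b) (f ⟨$⟩ʳ c) (trans (f-adj a b) a∼b , trans (f-adj b c) b∼c , trans (f-adj a c) a∼c)

⟨$⟩ʳ-injective : ∀ {m} (π : Permutation n m) → π ⟨$⟩ʳ a ≡ π ⟨$⟩ʳ b → a ≡ b
⟨$⟩ʳ-injective π πa≡πb = trans (sym (inverseˡ π)) (trans (cong (π ⟨$⟩ˡ_) πa≡πb) (inverseˡ π))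

≅-hubPair : ∀ {m} {G : Graph n} {H : Graph m} → G ≅ H → HubPair H ⊤ → HubPair G ⊤
≅-hubPair {G = G} {H} (f , f-adj) Hᴴ = record
  { u = f ⟨$⟩ˡ u ; v = f ⟨$⟩ˡ v ; u∈U = ∈⊤ ; v∈U = ∈⊤
  ; u≢v = λ u'≡v' → u≢v (trans (sym (inverseʳ f)) (trans (cong (f ⟨$⟩ʳ_) u'≡v') (inverseʳ f)))
  ; u≁v = trans (adj-via (inverseʳ f) (inverseʳ f)) u≁v
  ; v∼leaf = λ a-leaf → trans (adj-via (inverseʳ f) refl) (v∼leaf (to-leaf a-leaf))
  ; leaf≁leaf = λ a-leaf b-leaf → trans (adj-via refl refl) (leaf≁leaf (to-leaf a-leaf) (to-leaf b-leaf))
  ; u≁leaf-unique = λ a-leaf b-leaf u≁a u≁b → ⟨$⟩ʳ-injective f (u≁leaf-unique (to-leaf a-leaf) (to-leaf b-leaf)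
      (trans (sym (adj-via (inverseʳ f) refl)) u≁a) (trans (sym (adj-via (inverseʳ f) refl)) u≁b))
  }
  where
  open HubPair Hᴴ
  adj-via : ∀ {a b x y} → f ⟨$⟩ʳ a ≡ x → f ⟨$⟩ʳ b ≡ y → Adj G a b ≡ Adj H x y
  adj-via {a} {b} refl refl = sym (f-adj a b)
  to-leaf : ∀ {a} → Leaf ⊤ (f ⟨$⟩ˡ u) (f ⟨$⟩ˡ v) a → Leaf ⊤ u v (f ⟨$⟩ʳ a)
  to-leaf (_ , a≢u' , a≢v') =
    ∈⊤ , (λ fa≡u → a≢u' (trans (sym (inverseˡ f)) (cong (f ⟨$⟩ˡ_) fa≡u))) ,
         (λ fa≡v → a≢v' (trans (sym (inverseˡ f)) (cong (f ⟨$⟩ˡ_) fa≡v)))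

private
  beyond-hubs : ∀ {m} {a : Fin (2 + m)} → Leaf ⊤ zero (suc zero) a → ∃ λ j → a ≡ suc (suc j)
  beyond-hubs {a = zero}          (_ , a≢0 , _)   = ⊥-elim (a≢0 refl)
  beyond-hubs {a = suc zero}      (_ , _   , a≢1) = ⊥-elim (a≢1 refl)
  beyond-hubs {a = suc (suc j)}   _               = j , refl

completeBip-hubPair : 3 ≤ n → HubPair (completeBip n 2) ⊤
completeBip-hubPair {n = suc (suc (suc m))} (s≤s (s≤s (s≤s _))) = record
  { u = zero ; v = suc zero ; u∈U = ∈⊤ ; v∈U = ∈⊤ ; u≢v = λ () ; u≁v = refl
  ; v∼leaf = v∼leaf ; leaf≁leaf = leaf≁leaf ; u≁leaf-unique = u≁leaf-unique }
  where
  K = completeBip (3 + m) 2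
  v∼leaf : Leaf ⊤ zero (suc zero) a → Adj K (suc zero) a ≡ true
  v∼leaf a-leaf with beyond-hubs a-leaf
  ... | _ , refl = refl
  leaf≁leaf : Leaf ⊤ zero (suc zero) a → Leaf ⊤ zero (suc zero) b → Adj K a b ≡ false
  leaf≁leaf a-leaf b-leaf with beyond-hubs a-leaf | beyond-hubs b-leaf
  ... | _ , refl | _ , refl = refl
  u≁leaf-unique : Leaf ⊤ zero (suc zero) a → Leaf ⊤ zero (suc zero) b → Adj K zero a ≡ false → Adj K zero b ≡ false → a ≡ b
  u≁leaf-unique a-leaf _ u≁a _ with beyond-hubs a-leaf
  ... | _ , refl with () ← u≁a

completeBip⁻-hubPair : 3 ≤ n → HubPair (deleteEdge (completeBip n 2) 0 2) ⊤
completeBip⁻-hubPair {n = suc (suc (suc m))} (s≤s (s≤s (s≤s _))) = record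
  { u = zero ; v = suc zero ; u∈U = ∈⊤ ; v∈U = ∈⊤ ; u≢v = λ () ; u≁v = refl
  ; v∼leaf = v∼leaf ; leaf≁leaf = leaf≁leaf ; u≁leaf-unique = u≁leaf-unique }
  where
  K⁻ = deleteEdge (completeBip (3 + m) 2) 0 2
  v∼leaf : Leaf ⊤ zero (suc zero) a → Adj K⁻ (suc zero) a ≡ true
  v∼leaf a-leaf with beyond-hubs a-leaf
  ... | _ , refl = refl
  leaf≁leaf : Leaf ⊤ zero (suc zero) a → Leaf ⊤ zero (suc zero) b → Adj K⁻ a b ≡ false
  leaf≁leaf a-leaf b-leaf with beyond-hubs a-leaf | beyond-hubs b-leaf
  ... | _ , refl | _ , refl = refl
  only-2 : ∀ j → Adj K⁻ zero (suc (suc j)) ≡ false → j ≡ zero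
  only-2 zero    _ = refl
  only-2 (suc j) ()
  u≁leaf-unique : Leaf ⊤ zero (suc zero) a → Leaf ⊤ zero (suc zero) b → Adj K⁻ zero a ≡ false → Adj K⁻ zero b ≡ false → a ≡ b
  u≁leaf-unique a-leaf b-leaf u≁a u≁b with beyond-hubs a-leaf | beyond-hubs b-leaf
  ... | i , refl | j , refl = cong (λ j → suc (suc j)) (trans (only-2 i u≁a) (sym (only-2 j u≁b)))

⟨$⟩ˡ-of : ∀ (π : Permutation′ n) {a i} → π ⟨$⟩ʳ a ≡ i → π ⟨$⟩ˡ i ≡ a
⟨$⟩ˡ-of π refl = inverseˡ π

⟨$⟩ˡ-avoids : ∀ (π : Permutation′ n) {a i j} → π ⟨$⟩ʳ a ≡ i → j ≢ i → π ⟨$⟩ˡ j ≢ a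
⟨$⟩ˡ-avoids π πa≡i j≢i σj≡a = j≢i (trans (sym (inverseʳ π)) (trans (cong (π ⟨$⟩ʳ_) σj≡a) πa≡i))

moveTo : Permutation′ n → Fin n → Fin n → Permutation′ n
moveTo π x i = π ∘ₚ transpose (π ⟨$⟩ʳ x) i

moveTo-sends : ∀ (π : Permutation′ n) x i → moveTo π x i ⟨$⟩ʳ x ≡ i
moveTo-sends π x i rewrite dec-true (π ⟨$⟩ʳ x ≟ π ⟨$⟩ʳ x) refl = refl

moveTo-keeps : ∀ (π : Permutation′ n) {x i y j} → y ≢ x → π ⟨$⟩ʳ y ≡ j → j ≢ i → moveTo π x i ⟨$⟩ʳ y ≡ j
moveTo-keeps π {x} {i} {y} y≢x refl j≢i
  rewrite dec-false (π ⟨$⟩ʳ y ≟ π ⟨$⟩ʳ x) (y≢x ∘ ⟨$⟩ʳ-injective π) | dec-false (π ⟨$⟩ʳ y ≟ i) j≢i = refl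

≅-of-positions : ∀ {G H : Graph n} (π : Permutation′ n) →
                 (∀ x y → Adj G (π ⟨$⟩ˡ x) (π ⟨$⟩ˡ y) ≡ Adj H x y) → G ≅ H
≅-of-positions {G = G} π adj =
  π , λ a b → trans (sym (adj (π ⟨$⟩ʳ a) (π ⟨$⟩ʳ b))) (cong₂ (Adj G) (inverseˡ π) (inverseˡ π))

module _ {m} {G : Graph (3 + m)} (H : HubPair G ⊤) where
  open HubPair H

  private
    π₂ : Permutation′ (3 + m)
    π₂ = moveTo (moveTo id u zero) v (suc zero)

    π₂u : π₂ ⟨$⟩ʳ u ≡ zero
    π₂u = moveTo-keeps (moveTo id u zero) u≢v (moveTo-sends id u zero) λ ()

    π₂v : π₂ ⟨$⟩ʳ v ≡ suc zero
    π₂v = moveTo-sends (moveTo id u zero) v (suc zero)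

    at : ∀ {x y a b t} → x ≡ a → y ≡ b → Adj G a b ≡ t → Adj G x y ≡ t
    at refl refl a∼?b = a∼?b

  ≅-complete : (∀ {a} → Leaf ⊤ u v a → Adj G u a ≡ true) → G ≅ completeBip (3 + m) 2
  ≅-complete u∼leaf = ≅-of-positions {G = G} {completeBip (3 + m) 2} π₂ adj
    where
    σu = ⟨$⟩ˡ-of π₂ π₂u
    σv = ⟨$⟩ˡ-of π₂ π₂v
    leaf : ∀ j → Leaf ⊤ u v (π₂ ⟨$⟩ˡ suc (suc j))
    leaf j = ∈⊤ , ⟨$⟩ˡ-avoids π₂ {j = suc (suc j)} π₂u (λ ()) , ⟨$⟩ˡ-avoids π₂ {j = suc (suc j)} π₂v (λ ())
    adj : ∀ x y → Adj G (π₂ ⟨$⟩ˡ x) (π₂ ⟨$⟩ˡ y) ≡ Adj (completeBip (3 + m) 2) x y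
    adj zero          zero          = irrfl G _
    adj zero          (suc zero)    = at σu σv u≁v
    adj zero          (suc (suc j)) = at σu refl (u∼leaf (leaf j))
    adj (suc zero)    zero          = at σv σu (adj-sym G u≁v)
    adj (suc zero)    (suc zero)    = irrfl G _
    adj (suc zero)    (suc (suc j)) = at σv refl (v∼leaf (leaf j))
    adj (suc (suc i)) zero          = at refl σu (adj-sym G (u∼leaf (leaf i)))
    adj (suc (suc i)) (suc zero)    = at refl σv (adj-sym G (v∼leaf (leaf i)))
    adj (suc (suc i)) (suc (suc j)) = leaf≁leaf (leaf i) (leaf j)

  ≅-deleted : ∀ {a₀} → Leaf ⊤ u v a₀ → Adj G u a₀ ≡ false → G ≅ deleteEdge (completeBip (3 + m) 2) 0 2
  ≅-deleted {a₀} a₀-leaf@(_ , a₀≢u , a₀≢v) u≁a₀ = ≅-of-positions {G = G} {deleteEdge (completeBip (3 + m) 2) 0 2} π₃ adj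
    where
    π₃ = moveTo π₂ a₀ (suc (suc zero))
    π₃u = moveTo-keeps π₂ (≢-sym a₀≢u) π₂u λ ()
    π₃v = moveTo-keeps π₂ (≢-sym a₀≢v) π₂v λ ()
    π₃a₀ = moveTo-sends π₂ a₀ (suc (suc zero))
    σu = ⟨$⟩ˡ-of π₃ π₃u
    σv = ⟨$⟩ˡ-of π₃ π₃v
    σa₀ = ⟨$⟩ˡ-of π₃ π₃a₀
    leaf : ∀ j → Leaf ⊤ u v (π₃ ⟨$⟩ˡ suc (suc (suc j)))
    leaf j = ∈⊤ , ⟨$⟩ˡ-avoids π₃ {j = suc (suc (suc j))} π₃u (λ ()) , ⟨$⟩ˡ-avoids π₃ {j = suc (suc (suc j))} π₃v (λ ())
    u∼leaf : ∀ j → Adj G u (π₃ ⟨$⟩ˡ suc (suc (suc j))) ≡ true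
    u∼leaf j = ¬-not λ u≁σj →
      ⟨$⟩ˡ-avoids π₃ {j = suc (suc (suc j))} π₃a₀ (λ ()) (u≁leaf-unique (leaf j) a₀-leaf u≁σj u≁a₀)
    adj : ∀ x y → Adj G (π₃ ⟨$⟩ˡ x) (π₃ ⟨$⟩ˡ y) ≡ Adj (deleteEdge (completeBip (3 + m) 2) 0 2) x y
    adj zero                zero                = irrfl G _
    adj zero                (suc zero)          = at σu σv u≁v
    adj zero                (suc (suc zero))    = at σu σa₀ u≁a₀
    adj zero                (suc (suc (suc j))) = at σu refl (u∼leaf j)
    adj (suc zero)          zero                = at σv σu (adj-sym G u≁v)
    adj (suc zero)          (suc zero)          = irrfl G _
    adj (suc zero)          (suc (suc zero))    = at σv σa₀ (v∼leaf a₀-leaf)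
    adj (suc zero)          (suc (suc (suc j))) = at σv refl (v∼leaf (leaf j))
    adj (suc (suc zero))    zero                = at σa₀ σu (adj-sym G u≁a₀)
    adj (suc (suc zero))    (suc zero)          = at σa₀ σv (adj-sym G (v∼leaf a₀-leaf))
    adj (suc (suc zero))    (suc (suc zero))    = irrfl G _
    adj (suc (suc zero))    (suc (suc (suc j))) = at σa₀ refl (leaf≁leaf a₀-leaf (leaf j))
    adj (suc (suc (suc i))) zero                = at refl σu (adj-sym G (u∼leaf i))
    adj (suc (suc (suc i))) (suc zero)          = at refl σv (adj-sym G (v∼leaf (leaf i)))
    adj (suc (suc (suc i))) (suc (suc zero))    = at refl σa₀ (leaf≁leaf (leaf i) a₀-leaf)
    adj (suc (suc (suc i))) (suc (suc (suc j))) = leaf≁leaf (leaf i) (leaf j)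

  ≅-complete-or-deleted : G ≅ completeBip (3 + m) 2 ⊎ G ≅ deleteEdge (completeBip (3 + m) 2) 0 2
  ≅-complete-or-deleted with any? (λ a → ¬? (a ≟ u) ×-dec ¬? (a ≟ v) ×-dec (Adj G u a Bool.≟ false))
  ... | yes (a₀ , a₀≢u , a₀≢v , u≁a₀) = inj₂ (≅-deleted (∈⊤ , a₀≢u , a₀≢v) u≁a₀)
  ... | no  none = inj₁ (≅-complete λ (_ , a≢u , a≢v) → ¬-not λ u≁a → none (_ , a≢u , a≢v , u≁a))

hubPair⇒≅ : ∀ {G : Graph n} → 3 ≤ n → HubPair G ⊤ → G ≅ completeBip n 2 ⊎ G ≅ deleteEdge (completeBip n 2) 0 2
hubPair⇒≅ (s≤s (s≤s (s≤s _))) = ≅-complete-or-deleted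

module _ {k} (3≤k : 3 ≤ k) where

  private
    ∣⊤-0∣≡4+k : ∣ ⊤ {5 + k} - zero ∣ ≡ 4 + k
    ∣⊤-0∣≡4+k = ∣p-x∣≡pred (⊤ {5 + k}) {zero} ∈⊤ (∣⊤∣≡n (5 + k))

    ∣⊤∣≡4+k : ∣ ⊤ {k + 4} ∣ ≡ 4 + k
    ∣⊤∣≡4+k = trans (∣⊤∣≡n (k + 4)) (+-comm k 4)

  everyTF-has : n ≡ 5 + k → EveryTFHas k (k + 3) n
  everyTF-has refl G tf with any? (λ x → (x ∈? ⊤ - zero) ×-dec sparse? k G (⊤ - zero - x))
  ... | yes (x , x∈U , sparse) = ⊤ - zero - x , trans (∣p-x∣≡pred (⊤ - zero) {x} x∈U ∣⊤-0∣≡4+k) (+-comm 3 k) , sparse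
  ... | no  none = 3+k⇒k+3 (sparse-set {G = G} tf 3≤k (∣⊤∣≡n (5 + k)) {zero}
                     (hubPair-of-¬sparse-deletions {G = G} tf 3≤k {U = ⊤ - zero} ∣⊤-0∣≡4+k λ x x∈U sparse → none (x , x∈U , sparse)))
    where
    3+k⇒k+3 : (Σ (Subset _) λ S → ∣ S ∣ ≡ 3 + k × Sparse k G S) → HasSparseSet k (k + 3) G
    3+k⇒k+3 (S , ∣S∣≡3+k , sparse) = S , trans ∣S∣≡3+k (+-comm 3 k) , sparse

  ¬everyTF-has : n < k + 5 → ¬ EveryTFHas k (k + 3) n
  ¬everyTF-has {n} n<k+5 every with every (completeBip n 2) (completeBip-triangleFree n 2) | n ≟ℕ 4 + k | n ≟ℕ 3 + k
  ... | S , ∣S∣≡k+3 , sparse | yes refl | _ =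
    ¬sparse (completeBip-hubPair (≤-trans (n≤1+n 3) (m≤m+n 4 k))) (∣⊤∣≡n (4 + k)) {S} (λ _ → ∈⊤) (trans ∣S∣≡k+3 (+-comm k 3)) sparse
  ... | S , ∣S∣≡k+3 , sparse | no _ | yes refl =
    ¬sparse-∋v (completeBip-hubPair (m≤m+n 3 k)) {S} (λ _ → ∈⊤) ∣S∣≡3+k (subst (_ ∈_) (sym (∣p∣≡n⇒p≡⊤ ∣S∣≡3+k)) ∈⊤) sparse
    where ∣S∣≡3+k = trans ∣S∣≡k+3 (+-comm k 3)
  ... | S , ∣S∣≡k+3 , _ | no n≢4+k | no n≢3+k = 1+n≰n (begin
      3 + k      ≡⟨ trans ∣S∣≡k+3 (+-comm k 3) ⟨
      ∣ S ∣      ≤⟨ ∣p∣≤n S ⟩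
      n          ≤⟨ ≤-pred (≤∧≢⇒< (≤-pred (≤∧≢⇒< (≤-pred (subst (n <_) (+-comm k 5) n<k+5)) n≢4+k)) n≢3+k) ⟩
      2 + k      ∎)
    where open ≤-Reasoning

  extremal⇔ : (G : Graph (k + 4)) → Extremal k (k + 3) G ⇔
              (G ≅ completeBip (k + 4) 2 ⊎ G ≅ deleteEdge (completeBip (k + 4) 2) 0 2)
  extremal⇔ G = mk⇔ to from
    where
    3≤k+4 : 3 ≤ k + 4
    3≤k+4 = ≤-trans (n≤1+n 3) (m≤n+m 4 k)

    to : Extremal k (k + 3) G → G ≅ completeBip (k + 4) 2 ⊎ G ≅ deleteEdge (completeBip (k + 4) 2) 0 2
    to (tf , ¬sparse-set) = hubPair⇒≅ 3≤k+4 (hubPair-of-¬sparse-deletions {G = G} tf 3≤k {U = ⊤} ∣⊤∣≡4+k λ x _ sparse →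
      ¬sparse-set (⊤ - x , trans (∣p-x∣≡pred ⊤ {x} ∈⊤ ∣⊤∣≡4+k) (+-comm 3 k) , sparse))

    extremal-of-≅ : ∀ {H : Graph (k + 4)} → G ≅ H → TriangleFree H → HubPair H ⊤ → Extremal k (k + 3) G
    extremal-of-≅ {H} G≅H tfH hubs = ≅-triangleFree {G = G} {H} G≅H tfH , λ (S , ∣S∣≡k+3 , sparse) →
      ¬sparse (≅-hubPair {G = G} {H} G≅H hubs) ∣⊤∣≡4+k {S} (λ _ → ∈⊤) (trans ∣S∣≡k+3 (+-comm k 3)) sparse

    from : G ≅ completeBip (k + 4) 2 ⊎ G ≅ deleteEdge (completeBip (k + 4) 2) 0 2 → Extremal k (k + 3) G
    from (inj₁ G≅K)  = extremal-of-≅ G≅K (completeBip-triangleFree (k + 4) 2) (completeBip-hubPair 3≤k+4)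
    from (inj₂ G≅K⁻) = extremal-of-≅ G≅K⁻ (deleteEdge-triangleFree (completeBip (k + 4) 2) 0 2 (completeBip-triangleFree (k + 4) 2))
                                      (completeBip⁻-hubPair 3≤k+4)

theorem3p7 : (k : ℕ) → 3 ≤ k →
    IsT k (k + 3) (k + 5) ×
    ((G : Graph (k + 4)) →
      Extremal k (k + 3) G ⇔
        (G ≅ completeBip (k + 4) 2 ⊎ G ≅ deleteEdge (completeBip (k + 4) 2) 0 2))
theorem3p7 k 3≤k = (everyTF-has 3≤k (+-comm k 5) , λ _ → ¬everyTF-has 3≤k) , extremal⇔ 3≤k
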